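{- Consider the divide-and-conquer polynomial evaluation algorithm described in the context, run on a polynomial $A=(a_0,\dots,a_{n-1})$ with $n$ coefficients. Let $\zeta$ be the number of zero coefficients of $A$, and let $\langle n_1,\dots,n_\eta\rangle$ be the sizes of the $\eta$ equivalence classes of the relation $E$ (defined in the context) on the positions of the zero coefficients, so that $\sum_{i=1}^{\eta} n_i=\zeta$. Then the running time of the algorithm on $A$ is within $O\big((n-\zeta)\log n+\sum_{i=1}^{\eta} n_i\log\frac{n}{n_i}\big)\subseteq O(n\log n)$.
   Context: A polynomial $A(x)=\sum_{j=0}^{n-1}a_jx^j$ is given by its coefficient vector $(a_0,\dots,a_{n-1})$. The evaluation algorithm (the divide-and-conquer step of FFT-based polynomial multiplication) evaluates $A$ at all $(2n)$-th roots of unity as follows: it forms $A_{even}$ and $A_{odd}$, the polynomials whose coefficient vectors are the even-indexed and odd-indexed coefficients of $A$ respectively, so that $A(x)=A_{even}(x^2)+x\,A_{odd}(x^2)$; it recursively evaluates $A_{even}$ and $A_{odd}$ at the $n$-th roots of unity, and then combines these values in linear time to obtain $A$ at each $(2n)$-th root of unity. If at some recursive call all coefficients of the current polynomial are zero, the algorithm terminates that branch immediately. Equivalence relation $E$ on positions of zero coefficients of $A$: two positions $p,q$ with $a_p=a_q=0$ are equivalent iff (i) there exists $k\in\mathbb{Z}^+$ with $p\equiv q \pmod{2^k}$; (ii) all positions $r$ with $r\equiv p\pmod{2^k}$ hold zero coefficients; and (iii) there exists a position $t$ with $t\equiv p\pmod{2^{k-1}}$ whose coefficient is nonzero. (Intuitively,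 a class consists of the positions forming a vector of all-zero coefficients at one node of the recursion tree.) -}

module Defs where

open import Data.Nat using (ℕ; zero; suc; _+_; _*_; _∸_; _^_; _≤_; _/_; _%_)
open import Data.Nat.Properties using (m^n≢0)
open import Data.Nat.Logarithm using (⌊log₂_⌋)
open import Data.Bool using (Bool; true; false; if_then_else_; _∧_)
open import Data.Fin using (Fin; toℕ)
open import Data.Vec using (Vec; []; _∷_; lookup; count)
open import Data.List using (List; []; length; map; concat)
open import Data.Nat.ListAction using (sum)
open import Data.List.Membership.Propositional using (_∈_)
open import Data.List.Relation.Unary.Unique.Propositional using (Unique)
open import Data.Product using (Σ; _×_; _,_; proj₁; proj₂)
open import Relation.Nullary using (¬_; does)
open import Relation.Binary.Definitions using (DecidableEquality)
open import Relation.Binary.PropositionalEquality using (_≡_; _≢_)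
open import Function.Bundles using (_⇔_)

-- pow2 m = 2^m, defined so that pow2 (suc m) = pow2 m * 2 reduces to
-- suc (suc …) when pow2 m = suc _, which makes even/odd splitting of a
-- coefficient vector of length 2^(m+1) structural.
pow2 : ℕ → ℕ
pow2 zero    = 1
pow2 (suc m) = pow2 m * 2

-- Coefficients live in an arbitrary type C with a distinguished zero 0C and
-- decidable equality (only zero / non-zero matters for the running time).
module _ {C : Set} (0C : C) (_≟_ : DecidableEquality C) where

  split : ∀ {k} → Vec C (k * 2) → Vec C k × Vec C k
  split {zero}  []           = [] , []
  split {suc k} (x ∷ y ∷ xs) = (x ∷ proj₁ (split xs)) , (y ∷ proj₂ (split xs))

  allZero : ∀ {n} → Vec C n → Bool
  allZero []       = true
  allZero (x ∷ xs) = does (x ≟ 0C) ∧ allZero xs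

  -- Running time (cost model) of the evaluation algorithm on a polynomial
  -- with n = 2^m coefficients:
  --  * every call first tests whether all coefficients are zero (charged n,
  --    a linear scan); if so the branch terminates;
  --  * a non-zero constant polynomial (n = 1) is evaluated at the 2 square
  --    roots of unity in constant time (charged 1, besides the scan);
  --  * otherwise both halves are evaluated recursively and the results are
  --    combined in linear time (charged 2n, the number of output values).
  mutual
    cost : (m : ℕ) → Vec C (pow2 m) → ℕ
    cost m a = pow2 m + (if allZero a then 0 else step m a)

    step : (m : ℕ) → Vec C (pow2 m) → ℕ
    step zero    a = 1
    step (suc m) a = cost m (proj₁ (split a)) + cost m (proj₂ (split a)) + pow2 (suc m) * 2

  module _ {n : ℕ} (a : Vec C n) where

    ZeroAt : Fin n → Set
    ZeroAt p = lookup a p ≡ 0C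

    CongMod2^ : ℕ → Fin n → Fin n → Set
    CongMod2^ k p q = (toℕ p % 2 ^ k) {{m^n≢0 2 k}} ≡ (toℕ q % 2 ^ k) {{m^n≢0 2 k}}

    -- The equivalence relation E on positions of zero coefficients,
    -- with k = suc j ∈ ℤ⁺ (so k - 1 = j).
    E : Fin n → Fin n → Set
    E p q = ZeroAt p × ZeroAt q ×
            Σ ℕ λ j →
              CongMod2^ (suc j) p q
              × (∀ r → CongMod2^ (suc j) r p → ZeroAt r)
              × Σ (Fin n) (λ t → CongMod2^ j t p × ¬ ZeroAt t)

    ζ : ℕ
    ζ = count (λ x → x ≟ 0C) a

    -- cls is (a listing of) the set of equivalence classes of E: each class
    -- is a non-empty duplicate-free list of positions, the classes are
    -- pairwise disjoint and together contain exactly the zero positions,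
    -- positions in one class are E-related, and each class is closed under E.
    IsEClasses : List (List (Fin n)) → Set
    IsEClasses cls =
        Unique (concat cls)
      × (∀ p → (p ∈ concat cls) ⇔ ZeroAt p)
      × (∀ c → c ∈ cls → c ≢ [])
      × (∀ c → c ∈ cls → ∀ p q → p ∈ c → q ∈ c → E p q)
      × (∀ c → c ∈ cls → ∀ p q → p ∈ c → E p q → q ∈ c)

-- ⌊log₂ (n / d)⌋ (d = 0 never occurs for class sizes; set to 0 then).
logDiv : ℕ → ℕ → ℕ
logDiv n zero    = 0
logDiv n (suc d) = ⌊log₂ (n / suc d) ⌋

classSum : ∀ {n : ℕ} → List (List (Fin n)) → ℕ
classSum {n} cls = sum (map (λ c → length c * logDiv n (length c)) cls)

bound : ∀ {C : Set} (0C : C) (_≟_ : DecidableEquality C) {n : ℕ} →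
        Vec C n → List (List (Fin n)) → ℕ
bound 0C _≟_ {n} a cls = (n ∸ ζ 0C _≟_ a) * ⌊log₂ n ⌋ + classSum cls

module Submission where

-- For a coefficient vector a of length N = 2^m and a position x < N, let
-- depth m a x be the number of calls on the path from the root of the
-- recursion tree towards the leaf x that do not stop immediately (i.e. whose
-- polynomial is not identically zero), not counting the leaf call itself.
-- Every non-terminating call on a vector of size n > 1 is charged O(n), so
-- the running time is O(total) with total = Σ_{x<N} depth x (`cost-bound`).
--
-- Always depth x ≤ m = log N.  If x lies in
-- an E-class c of level K (the residue class of x modulo 2^K is entirely
-- zero, but not so modulo 2^(K-1)), the recursion stops at depth K on the way
-- to x, and c sits inside one residue class modulo 2^K, so |c| ≤ N / 2^K,
-- i.e. K ≤ log (N / |c|).  Summing the first bound over the non-zero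
-- positions and the second over the classes gives total ≤ bound
-- (`total≤bound`); comparing the class term with ζ·log N gives
-- bound ≤ N log N (`bound≤NlogN`).

open import Defs
open import Data.Bool using (Bool; true; false; if_then_else_)
open import Data.Empty using (⊥-elim)
open import Data.Fin using (Fin; toℕ; fromℕ<)
open import Data.Fin.Properties using (toℕ-injective; toℕ-fromℕ<; toℕ<n)
open import Data.List using (List; []; _∷_; _++_; map; length; concat; filter; tabulate; applyUpTo; allFin)
open import Data.List.Membership.Propositional using (_∈_; find)
open import Data.List.Membership.Propositional.Properties
  using (∈-∃++; ∈-++⁻; ∈-++⁺ˡ; ∈-++⁺ʳ; ∈-map⁻; ∈-concat⁻; ∈-filter⁺; ∈-filter⁻; ∈-allFin; ∈-applyUpTo⁺)
open import Data.List.Properties using (map-++; map-tabulate; length-map; length-applyUpTo; length-tabulate; length-filter)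
open import Data.List.Relation.Binary.Subset.Propositional using (_⊆_)
open import Data.List.Relation.Unary.All as All using ()
open import Data.List.Relation.Unary.All.Properties using (++⁻ˡ)
open import Data.List.Relation.Unary.Any using (here; there)
open import Data.List.Relation.Unary.AllPairs using ([]; _∷_)
open import Data.List.Relation.Unary.Unique.Propositional using (Unique)
open import Data.List.Relation.Unary.Unique.Propositional.Properties as Unique using (allFin⁺)
open import Data.Nat using (ℕ; zero; suc; _+_; _*_; _∸_; _^_; _≤_; _<_; z≤n; s≤s; _%_; _/_; ⌊_/2⌋; NonZero)
open import Data.Nat.DivMod using (n%1≡0; m≡m%n+[m/n]*n; [m+kn]%n≡m%n; m<n⇒m%n≡m; m%n<n; m∣n⇒o%n%m≡o%m; m<n*o⇒m/o<n; m*n/n≡m; /-monoˡ-≤; m/n≤m)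
open import Data.Nat.Divisibility using (divides)
open import Data.Nat.ListAction using (sum)
open import Data.Nat.ListAction.Properties using (sum-++)
open import Data.Nat.Logarithm using (⌊log₂_⌋; ⌊log₂⌋-mono-≤; ⌊log₂[2^n]⌋≡n)
open import Data.Nat.Properties
open import Data.Nat.Solver using (module +-*-Solver)
open import Data.Product using (Σ; _×_; _,_; proj₁; proj₂)
open import Data.Sum using (inj₁; inj₂)
open import Data.Vec as Vec using (Vec; _∷_; lookup; count)
open import Data.Vec.Properties using (tabulate∘lookup)
open import Function using (_∘_)
open import Function.Bundles using (Equivalence; _⇔_)
open import Relation.Binary.Definitions using (DecidableEquality)
open import Relation.Binary.PropositionalEquality
open import Relation.Nullary using (¬_; Dec; does; yes; no; ¬?)
open import Relation.Unary using (Pred; Decidable)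
open import Level using (Level)

open import Algebra.Properties.CommutativeSemigroup +-commutativeSemigroup using (x∙yz≈y∙xz)
open +-*-Solver using (solve; _:+_; _:*_; con; _:=_)

sumOver : {A : Set} → (A → ℕ) → List A → ℕ
sumOver f xs = sum (map f xs)

module _ {A : Set} where

  sumOver-++ : (f : A → ℕ) (xs ys : List A) → sumOver f (xs ++ ys) ≡ sumOver f xs + sumOver f ys
  sumOver-++ f xs ys = trans (cong sum (map-++ f xs ys)) (sum-++ (map f xs) (map f ys))

  sumOver-concat : (f : A → ℕ) (xss : List (List A)) → sumOver f (concat xss) ≡ sumOver (sumOver f) xss
  sumOver-concat f []         = refl
  sumOver-concat f (xs ∷ xss) = trans (sumOver-++ f xs (concat xss)) (cong (sumOver f xs +_) (sumOver-concat f xss))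

  sumOver-const : (c : ℕ) (xs : List A) → sumOver (λ _ → c) xs ≡ length xs * c
  sumOver-const c []       = refl
  sumOver-const c (x ∷ xs) = cong (c +_) (sumOver-const c xs)

  sumOver-mono : {f g : A → ℕ} (xs : List A) → (∀ {x} → x ∈ xs → f x ≤ g x) → sumOver f xs ≤ sumOver g xs
  sumOver-mono []       f≤g = z≤n
  sumOver-mono (x ∷ xs) f≤g = +-mono-≤ (f≤g (here refl)) (sumOver-mono xs (f≤g ∘ there))

  sumOver-partition : {p : Level} {P : Pred A p} (P? : Decidable P) (f : A → ℕ) (xs : List A) →
                      sumOver f xs ≡ sumOver f (filter P? xs) + sumOver f (filter (¬? ∘ P?) xs)
  sumOver-partition P? f []       = refl
  sumOver-partition P? f (x ∷ xs) with does (P? x)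
  ... | true  = trans (cong (f x +_) (sumOver-partition P? f xs))
                      (sym (+-assoc (f x) (sumOver f (filter P? xs)) (sumOver f (filter (¬? ∘ P?) xs))))
  ... | false = trans (cong (f x +_) (sumOver-partition P? f xs))
                      (x∙yz≈y∙xz (f x) (sumOver f (filter P? xs)) (sumOver f (filter (¬? ∘ P?) xs)))

  sumOver-⊆ : (f : A → ℕ) {xs ys : List A} → Unique xs → xs ⊆ ys → sumOver f xs ≤ sumOver f ys
  sumOver-⊆ f {[]}     _            _    = z≤n
  sumOver-⊆ f {x ∷ xs} (x∉xs ∷ uxs) x∷xs⊆ys with ∈-∃++ (x∷xs⊆ys (here refl))
  ... | us , vs , refl = begin
    f x + sumOver f xs             ≤⟨ +-monoʳ-≤ (f x) (sumOver-⊆ f uxs xs⊆us++vs) ⟩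
    f x + sumOver f (us ++ vs)     ≡⟨ cong (f x +_) (sumOver-++ f us vs) ⟩
    f x + (sumOver f us + sumOver f vs) ≡⟨ x∙yz≈y∙xz (f x) (sumOver f us) (sumOver f vs) ⟩
    sumOver f us + (f x + sumOver f vs) ≡⟨ sym (sumOver-++ f us (x ∷ vs)) ⟩
    sumOver f (us ++ x ∷ vs)       ∎
    where
    open ≤-Reasoning
    xs⊆us++vs : xs ⊆ us ++ vs
    xs⊆us++vs {y} y∈xs with ∈-++⁻ us (x∷xs⊆ys (there y∈xs))
    ... | inj₁ y∈us         = ∈-++⁺ˡ y∈us
    ... | inj₂ (here refl)  = ⊥-elim (All.lookup x∉xs y∈xs refl)
    ... | inj₂ (there y∈vs) = ∈-++⁺ʳ us y∈vs

  sumOver-one : (xs : List A) → sumOver (λ _ → 1) xs ≡ length xs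
  sumOver-one xs = trans (sumOver-const 1 xs) (*-identityʳ (length xs))

  length-⊆ : {xs ys : List A} → Unique xs → xs ⊆ ys → length xs ≤ length ys
  length-⊆ {xs} {ys} uxs xs⊆ys = subst₂ _≤_ (sumOver-one xs) (sumOver-one ys) (sumOver-⊆ (λ _ → 1) uxs xs⊆ys)

  unique-concat : {xs : List A} {xss : List (List A)} → Unique (concat xss) → xs ∈ xss → Unique xs
  unique-concat {xss = ys ∷ xss} u (here refl) = unique-++ˡ ys u
    where
    unique-++ˡ : ∀ (ys : List A) {zs} → Unique (ys ++ zs) → Unique ys
    unique-++ˡ []       _          = []
    unique-++ˡ (y ∷ ys) (y∉ ∷ u′) = ++⁻ˡ ys y∉ ∷ unique-++ˡ ys u′
  unique-concat {xss = ys ∷ xss} u (there xs∈) = unique-concat (drop-block ys u) xs∈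
    where
    drop-block : ∀ (ys : List A) {zs} → Unique (ys ++ zs) → Unique zs
    drop-block []       u′        = u′
    drop-block (y ∷ ys) (_ ∷ u′) = drop-block ys u′

count-filter : {A : Set} {p : Level} {P : Pred A p} (P? : Decidable P) {n : ℕ} (a : Vec A n) →
               count P? a ≡ length (filter (P? ∘ lookup a) (allFin n))
count-filter P? {n} a = begin
  count P? a                                  ≡⟨ cong (count P?) (sym (tabulate∘lookup a)) ⟩
  count P? (Vec.tabulate (lookup a))          ≡⟨ count-tabulate (lookup a) (λ i → i) ⟩
  length (filter (P? ∘ lookup a) (allFin n))  ∎
  where
  open ≡-Reasoning
  count-tabulate : ∀ {k m} (f : Fin k → _) (g : Fin m → Fin k) →
                   count P? (Vec.tabulate (f ∘ g)) ≡ length (filter (P? ∘ f) (tabulate g))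
  count-tabulate {m = zero}  f g = refl
  count-tabulate {m = suc m} f g with does (P? (f (g Fin.zero)))
  ... | true  = cong suc (count-tabulate f (g ∘ Fin.suc))
  ... | false = count-tabulate f (g ∘ Fin.suc)

Σ< : (ℕ → ℕ) → ℕ → ℕ
Σ< f n = sum (applyUpTo f n)

Σ<-cong : {f g : ℕ → ℕ} → (∀ i → f i ≡ g i) → ∀ n → Σ< f n ≡ Σ< g n
Σ<-cong f≡g zero    = refl
Σ<-cong f≡g (suc n) = cong₂ _+_ (f≡g 0) (Σ<-cong (f≡g ∘ suc) n)

Σ<-suc : (f : ℕ → ℕ) (n : ℕ) → Σ< (suc ∘ f) n ≡ n + Σ< f n
Σ<-suc f zero    = refl
Σ<-suc f (suc n) = cong suc (trans (cong (f 0 +_) (Σ<-suc (f ∘ suc) n)) (x∙yz≈y∙xz (f 0) n _))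

Σ<-interleave : (f : ℕ → ℕ) (k : ℕ) → Σ< f (k * 2) ≡ Σ< (λ i → f (i * 2)) k + Σ< (λ i → f (suc (i * 2))) k
Σ<-interleave f zero    = refl
Σ<-interleave f (suc k) = trans (cong (λ s → f 0 + (f 1 + s)) (Σ<-interleave (f ∘ suc ∘ suc) k))
  (solve 4 (λ a b c d → a :+ (b :+ (c :+ d)) := (a :+ c) :+ (b :+ d)) refl (f 0) (f 1) _ _)

Σ<-allFin : (f : ℕ → ℕ) (n : ℕ) → sumOver (f ∘ toℕ) (allFin n) ≡ Σ< f n
Σ<-allFin f n = trans (cong sum (map-tabulate {n = n} (λ i → i) (f ∘ toℕ))) (tabulate-toℕ f n)
  where
  tabulate-toℕ : (f : ℕ → ℕ) (n : ℕ) → sum (tabulate {n = n} (f ∘ toℕ)) ≡ Σ< f n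
  tabulate-toℕ f zero    = refl
  tabulate-toℕ f (suc n) = cong (f 0 +_) (tabulate-toℕ (f ∘ suc) n)

bit : Bool → ℕ
bit false = 0
bit true  = 1

lowBit : ℕ → Bool
lowBit zero          = false
lowBit (suc zero)    = true
lowBit (suc (suc x)) = lowBit x

lowBit-digit : ∀ b y → lowBit (bit b + y * 2) ≡ b
lowBit-digit false zero    = refl
lowBit-digit true  zero    = refl
lowBit-digit false (suc y) = lowBit-digit false y
lowBit-digit true  (suc y) = lowBit-digit true y

half-digit : ∀ b y → ⌊ bit b + y * 2 /2⌋ ≡ y
half-digit false zero    = refl
half-digit true  zero    = refl
half-digit false (suc y) = cong suc (half-digit false y)
half-digit true  (suc y) = cong suc (half-digit true y)

digits : ∀ x → bit (lowBit x) + ⌊ x /2⌋ * 2 ≡ x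
digits zero          = refl
digits (suc zero)    = refl
digits (suc (suc x)) = trans (+-suc (bit (lowBit x)) (suc (⌊ x /2⌋ * 2)))
                             (cong suc (trans (+-suc _ _) (cong suc (digits x))))

digit-< : ∀ b {y k} → y < k → bit b + y * 2 < k * 2
digit-< b {y} y<k = ≤-trans (s≤s (+-monoˡ-≤ (y * 2) (bit≤1 b))) (*-monoˡ-≤ 2 y<k)
  where
  bit≤1 : ∀ b → bit b ≤ 1
  bit≤1 false = z≤n
  bit≤1 true  = s≤s z≤n

-- Residues modulo powers of two (the same expression as in CongMod2^)

residue : ℕ → ℕ → ℕ
residue K x = (x % 2 ^ K) {{m^n≢0 2 K}}

residue-digit : ∀ K b y → residue (suc K) (bit b + y * 2) ≡ bit b + residue K y * 2
residue-digit K b y = begin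
  (bit b + y * 2) % (2 * M)                            ≡⟨ cong (λ z → (bit b + z * 2) % (2 * M)) (m≡m%n+[m/n]*n y M) ⟩
  (bit b + (y % M + (y / M) * M) * 2) % (2 * M)        ≡⟨ cong (_% (2 * M)) (regroup (bit b) (y % M) (y / M) M) ⟩
  (bit b + (y % M) * 2 + (y / M) * (2 * M)) % (2 * M)  ≡⟨ [m+kn]%n≡m%n (bit b + (y % M) * 2) (y / M) (2 * M) ⟩
  (bit b + (y % M) * 2) % (2 * M)                      ≡⟨ m<n⇒m%n≡m (subst (bit b + (y % M) * 2 <_) (*-comm M 2) (digit-< b (m%n<n y M))) ⟩
  bit b + (y % M) * 2                                  ∎
  where
  open ≡-Reasoning
  M = 2 ^ K
  instance
    M≢0 : NonZero M
    M≢0 = m^n≢0 2 K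
    2M≢0 : NonZero (2 * M)
    2M≢0 = m^n≢0 2 (suc K)
  regroup : ∀ b r q m → b + (r + q * m) * 2 ≡ b + r * 2 + q * (2 * m)
  regroup = solve 4 (λ b r q m → b :+ (r :+ q :* m) :* con 2 := (b :+ r :* con 2) :+ q :* (con 2 :* m)) refl

residue-weaken : ∀ {K L} x y → L ≤ K → residue K x ≡ residue K y → residue L x ≡ residue L y
residue-weaken {K} {L} x y L≤K eq = begin
  residue L x                         ≡⟨ sym (m∣n⇒o%n%m≡o%m (2 ^ L) (2 ^ K) x {{m^n≢0 2 L}} {{m^n≢0 2 K}} 2^L∣2^K) ⟩
  (residue K x % 2 ^ L) {{m^n≢0 2 L}} ≡⟨ cong (λ r → (r % 2 ^ L) {{m^n≢0 2 L}}) eq ⟩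
  (residue K y % 2 ^ L) {{m^n≢0 2 L}} ≡⟨ m∣n⇒o%n%m≡o%m (2 ^ L) (2 ^ K) y {{m^n≢0 2 L}} {{m^n≢0 2 K}} 2^L∣2^K ⟩
  residue L y                         ∎
  where
  open ≡-Reasoning
  2^L∣2^K = divides (2 ^ (K ∸ L)) (trans (cong (2 ^_) (sym (m∸n+n≡m L≤K))) (^-distribˡ-+-* 2 (K ∸ L) L))

residueClass-size : ∀ {M} .{{_ : NonZero M}} q r (xs : List ℕ) → Unique xs →
                    (∀ {x} → x ∈ xs → x < q * M × x % M ≡ r) → length xs ≤ q
residueClass-size {M} q r xs uxs inClass =
  subst (length xs ≤_) (length-applyUpTo member q) (length-⊆ uxs xs⊆class)
  where
  member : ℕ → ℕ
  member i = r + i * M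
  xs⊆class : xs ⊆ applyUpTo member q
  xs⊆class {x} x∈xs = subst (_∈ applyUpTo member q) (sym x≡) (∈-applyUpTo⁺ member (m<n*o⇒m/o<n x<qM))
    where
    x<qM = proj₁ (inClass x∈xs)
    x≡ : x ≡ member (x / M)
    x≡ = trans (m≡m%n+[m/n]*n x M) (cong (_+ (x / M) * M) (proj₂ (inClass x∈xs)))

pow2≡2^ : ∀ m → pow2 m ≡ 2 ^ m
pow2≡2^ zero    = refl
pow2≡2^ (suc m) = trans (*-comm (pow2 m) 2) (cong (2 *_) (pow2≡2^ m))

log-pow2 : ∀ m → ⌊log₂ (pow2 m) ⌋ ≡ m
log-pow2 m = trans (cong ⌊log₂_⌋ (pow2≡2^ m)) (⌊log₂[2^n]⌋≡n m)

logDiv-bound : ∀ n L K → suc L * 2 ^ K ≤ n → K ≤ logDiv n (suc L)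
logDiv-bound n L K fits = subst (_≤ ⌊log₂ (n / suc L) ⌋) (⌊log₂[2^n]⌋≡n K)
  (⌊log₂⌋-mono-≤ (subst (_≤ n / suc L) (m*n/n≡m (2 ^ K) (suc L))
    (/-monoˡ-≤ (suc L) (subst (_≤ n) (*-comm (suc L) (2 ^ K)) fits))))

logDiv≤log : ∀ n L → logDiv n L ≤ ⌊log₂ n ⌋
logDiv≤log n zero    = z≤n
logDiv≤log n (suc L) = ⌊log₂⌋-mono-≤ (m/n≤m n (suc L))

-- The algorithm: recursion depths and running time

module Algorithm {C : Set} (0C : C) (_≟_ : DecidableEquality C) where

  isZero : ∀ {n} → Vec C n → Bool
  isZero = allZero 0C _≟_

  coeff : ∀ {n} → Vec C n → ℕ → C
  coeff Vec.[]   x       = 0C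
  coeff (c ∷ cs) zero    = c
  coeff (c ∷ cs) (suc x) = coeff cs x

  coeff-toℕ : ∀ {n} (a : Vec C n) (p : Fin n) → coeff a (toℕ p) ≡ lookup a p
  coeff-toℕ (c ∷ cs) Fin.zero    = refl
  coeff-toℕ (c ∷ cs) (Fin.suc p) = coeff-toℕ cs p

  coeff-fromℕ< : ∀ {n} (a : Vec C n) {y} (y<n : y < n) → coeff a y ≡ lookup a (fromℕ< y<n)
  coeff-fromℕ< a y<n = trans (cong (coeff a) (sym (toℕ-fromℕ< y<n))) (coeff-toℕ a (fromℕ< y<n))

  isZero⇒zero : ∀ {n} (a : Vec C n) → isZero a ≡ true → ∀ p → lookup a p ≡ 0C
  isZero⇒zero (c ∷ cs) eq p with c ≟ 0C
  isZero⇒zero (c ∷ cs) eq Fin.zero    | yes c≡0 = c≡0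
  isZero⇒zero (c ∷ cs) eq (Fin.suc p) | yes _   = isZero⇒zero cs eq p
  isZero⇒zero (c ∷ cs) () p           | no _

  zero⇒isZero : ∀ {n} (a : Vec C n) → (∀ y → y < n → coeff a y ≡ 0C) → isZero a ≡ true
  zero⇒isZero Vec.[]       _    = refl
  zero⇒isZero (c ∷ cs) zeros with c ≟ 0C
  ... | yes _   = zero⇒isZero cs (λ y y<n → zeros (suc y) (s≤s y<n))
  ... | no c≢0 = ⊥-elim (c≢0 (zeros 0 (s≤s z≤n)))

  -- the half (even or odd coefficients) that contains the positions with a given lowest bit
  half : ∀ {k} → Bool → Vec C (k * 2) → Vec C k
  half false a = proj₁ (split 0C _≟_ a)
  half true  a = proj₂ (split 0C _≟_ a)

  coeff-half : ∀ {k} (a : Vec C (k * 2)) b y → coeff a (bit b + y * 2) ≡ coeff (half {k} b a) y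
  coeff-half {zero}  Vec.[] false y = refl
  coeff-half {zero}  Vec.[] true  y = refl
  coeff-half {suc k} (c ∷ c′ ∷ cs) false zero    = refl
  coeff-half {suc k} (c ∷ c′ ∷ cs) true  zero    = refl
  coeff-half {suc k} (c ∷ c′ ∷ cs) false (suc y) = coeff-half {k} cs false y
  coeff-half {suc k} (c ∷ c′ ∷ cs) true  (suc y) = coeff-half {k} cs true y

  depth : (m : ℕ) → Vec C (pow2 m) → ℕ → ℕ
  depth zero    a x = 0
  depth (suc m) a x = if isZero a then 0 else suc (depth m (half {pow2 m} (lowBit x) a) ⌊ x /2⌋)

  depth-digit : ∀ m (a : Vec C (pow2 (suc m))) → isZero a ≡ false →
                ∀ b y → depth (suc m) a (bit b + y * 2) ≡ suc (depth m (half {pow2 m} b a) y)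
  depth-digit m a nz b y rewrite nz | lowBit-digit b y | half-digit b y = refl

  depth≤m : ∀ m a x → depth m a x ≤ m
  depth≤m zero    a x = z≤n
  depth≤m (suc m) a x with isZero a
  ... | true  = z≤n
  ... | false = s≤s (depth≤m m _ _)

  depth≤level : ∀ m (a : Vec C (pow2 m)) K x →
                (∀ y → y < pow2 m → residue K y ≡ residue K x → coeff a y ≡ 0C) → depth m a x ≤ K
  depth≤level zero    a K       x zeros = z≤n
  depth≤level (suc m) a zero    x zeros
    rewrite zero⇒isZero a (λ y y<n → zeros y y<n (trans (n%1≡0 y) (sym (n%1≡0 x)))) = z≤n
  depth≤level (suc m) a (suc K) x zeros with isZero a
  ... | true  = z≤n
  ... | false = s≤s (depth≤level m (half {pow2 m} b a) K ⌊ x /2⌋ halfZeros)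
    where
    open ≡-Reasoning
    b = lowBit x
    halfZeros : ∀ y → y < pow2 m → residue K y ≡ residue K ⌊ x /2⌋ → coeff (half {pow2 m} b a) y ≡ 0C
    halfZeros y y<k y≡x = trans (sym (coeff-half {pow2 m} a b y)) (zeros (bit b + y * 2) (digit-< b y<k) (begin
      residue (suc K) (bit b + y * 2)          ≡⟨ residue-digit K b y ⟩
      bit b + residue K y * 2                  ≡⟨ cong (λ r → bit b + r * 2) y≡x ⟩
      bit b + residue K ⌊ x /2⌋ * 2            ≡⟨ sym (residue-digit K b ⌊ x /2⌋) ⟩
      residue (suc K) (bit b + ⌊ x /2⌋ * 2)    ≡⟨ cong (residue (suc K)) (digits x) ⟩
      residue (suc K) x                        ∎))

  total : (m : ℕ) → Vec C (pow2 m) → ℕ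
  total m a = Σ< (depth m a) (pow2 m)

  total-step : ∀ m (a : Vec C (pow2 (suc m))) → isZero a ≡ false →
               total (suc m) a ≡ pow2 (suc m) + (total m (half {pow2 m} false a) + total m (half {pow2 m} true a))
  total-step m a nz = begin
    Σ< (depth (suc m) a) (k * 2)
      ≡⟨ Σ<-interleave (depth (suc m) a) k ⟩
    Σ< (λ i → depth (suc m) a (i * 2)) k + Σ< (λ i → depth (suc m) a (suc (i * 2))) k
      ≡⟨ cong₂ _+_ (Σ<-cong (depth-digit m a nz false) k) (Σ<-cong (depth-digit m a nz true) k) ⟩
    Σ< (suc ∘ depth m e) k + Σ< (suc ∘ depth m o) k
      ≡⟨ cong₂ _+_ (Σ<-suc (depth m e) k) (Σ<-suc (depth m o) k) ⟩
    (k + total m e) + (k + total m o)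
      ≡⟨ solve 3 (λ k s t → (k :+ s) :+ (k :+ t) := k :* con 2 :+ (s :+ t)) refl k (total m e) (total m o) ⟩
    k * 2 + (total m e + total m o) ∎
    where
    open ≡-Reasoning
    k = pow2 m
    e = half {pow2 m} false a
    o = half {pow2 m} true a

  -- every visited call costs O(size of its vector); the visited calls are the
  -- root and the two children of each non-terminating call of size > 1, and
  -- the sizes of the non-terminating calls of size > 1 add up to total
  cost≤total : ∀ m (a : Vec C (pow2 m)) → cost 0C _≟_ m a ≤ 4 * total m a + 4 * pow2 m
  cost≤total m a with isZero a in eq
  cost≤total m       a | true  = ≤-trans (≤-reflexive (+-identityʳ _)) (≤-trans (m≤n*m (pow2 m) 4) (m≤n+m (4 * pow2 m) (4 * total m a)))
  cost≤total zero    a | false = s≤s (s≤s z≤n)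
  cost≤total (suc m) a | false = begin
    N + (cost 0C _≟_ m e + cost 0C _≟_ m o + N * 2)
      ≤⟨ +-monoʳ-≤ N (+-monoˡ-≤ (N * 2) (+-mono-≤ (cost≤total m e) (cost≤total m o))) ⟩
    N + ((4 * total m e + 4 * k) + (4 * total m o + 4 * k) + N * 2)
      ≤⟨ m≤m+n _ N ⟩
    N + ((4 * total m e + 4 * k) + (4 * total m o + 4 * k) + N * 2) + N
      ≡⟨ solve 3 (λ k s t → (k :* con 2 :+ ((con 4 :* s :+ con 4 :* k) :+ (con 4 :* t :+ con 4 :* k) :+ k :* con 2 :* con 2)) :+ k :* con 2
                          := con 4 :* (k :* con 2 :+ (s :+ t)) :+ con 4 :* (k :* con 2)) refl k (total m e) (total m o) ⟩
    4 * (N + (total m e + total m o)) + 4 * N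
      ≡⟨ cong (λ t → 4 * t + 4 * N) (sym (total-step m a eq)) ⟩
    4 * total (suc m) a + 4 * N ∎
    where
    open ≤-Reasoning
    k = pow2 m
    N = pow2 (suc m)
    e = half {pow2 m} false a
    o = half {pow2 m} true a

  -- when the root does not stop and N > 1, every position has depth ≥ 1
  size≤total : ∀ m (a : Vec C (pow2 m)) → isZero a ≡ false → pow2 m ≤ total m a + 1
  size≤total zero    a nz = ≤-refl
  size≤total (suc m) a nz =
    ≤-trans (m≤m+n (pow2 (suc m)) _) (≤-trans (≤-reflexive (sym (total-step m a nz))) (m≤m+n (total (suc m) a) 1))

  cost-bound : ∀ m (a : Vec C (pow2 m)) → isZero a ≡ false → cost 0C _≟_ m a ≤ 8 * total m a + 8
  cost-bound m a nz = begin
    cost 0C _≟_ m a            ≤⟨ cost≤total m a ⟩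
    4 * T + 4 * pow2 m         ≤⟨ +-monoʳ-≤ (4 * T) (*-monoʳ-≤ 4 (size≤total m a nz)) ⟩
    4 * T + 4 * (T + 1)        ≡⟨ solve 1 (λ t → con 4 :* t :+ con 4 :* (t :+ con 1) := con 8 :* t :+ con 4) refl T ⟩
    8 * T + 4                  ≤⟨ +-monoʳ-≤ (8 * T) (m≤m+n 4 4) ⟩
    8 * T + 8                  ∎
    where
    open ≤-Reasoning
    T = total m a

-- The equivalence classes E and the accounting of depths

module Classes {C : Set} (0C : C) (_≟_ : DecidableEquality C) (m : ℕ) (a : Vec C (pow2 m))
               (cls : List (List (Fin (pow2 m)))) (isE : IsEClasses 0C _≟_ a cls) where

  open Algorithm 0C _≟_

  N : ℕ
  N = pow2 m

  Zero : Fin N → Set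
  Zero = ZeroAt 0C _≟_ a

  zero? : (q : Fin N) → Dec (Zero q)
  zero? q = lookup a q ≟ 0C

  -- j is the level of p: its residue class modulo 2^(j+1) holds only zeros,
  -- its residue class modulo 2^j does not (the last two components of E p q)
  IsLevel : ℕ → Fin N → Set
  IsLevel j p = (∀ r → CongMod2^ 0C _≟_ a (suc j) r p → Zero r)
              × Σ (Fin N) λ t → CongMod2^ 0C _≟_ a j t p × ¬ Zero t

  level-unique : ∀ {p} j j′ → IsLevel j p → IsLevel j′ p → j ≡ j′
  level-unique j j′ lev lev′ = ≤-antisym (≮⇒≥ (not-below j′ j lev′ lev)) (≮⇒≥ (not-below j j′ lev lev′))
    where
    -- for j < j′ the witness t′ of level j′ would lie in the zero class of level j
    not-below : ∀ {p} j j′ → IsLevel j p → IsLevel j′ p → ¬ (j < j′)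
    not-below {p} j j′ (zeroClass , _) (_ , t′ , t′≡p , t′≢0) j<j′ =
      t′≢0 (zeroClass t′ (residue-weaken (toℕ t′) (toℕ p) j<j′ t′≡p))

  -- the level lies within the recursion depth: modulo 2^j with j ≥ m all
  -- positions would be distinct, so the witness t would be p itself
  level<m : ∀ {p} j → IsLevel j p → j < m
  level<m {p} j (zeroClass , t , t≡p , t≢0) = ≰⇒> (λ m≤j → t≢0 (subst Zero (sym (t≡p′ m≤j)) (zeroClass p refl)))
    where
    unreduced : ∀ q → m ≤ j → residue j (toℕ q) ≡ toℕ q
    unreduced q m≤j = m<n⇒m%n≡m {{m^n≢0 2 j}}
      (≤-trans (subst (toℕ q <_) (pow2≡2^ m) (toℕ<n q)) (^-monoʳ-≤ 2 m≤j))
    t≡p′ : m ≤ j → t ≡ p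
    t≡p′ m≤j = toℕ-injective (trans (sym (unreduced t m≤j)) (trans t≡p (unreduced p m≤j)))

  uniq : Unique (concat cls)
  uniq = proj₁ isE

  zero⇔ : ∀ p → (p ∈ concat cls) ⇔ Zero p
  zero⇔ = proj₁ (proj₂ isE)

  nonEmpty : ∀ c → c ∈ cls → c ≢ []
  nonEmpty = proj₁ (proj₂ (proj₂ isE))

  related : ∀ c → c ∈ cls → ∀ p q → p ∈ c → q ∈ c → E 0C _≟_ a p q
  related = proj₁ (proj₂ (proj₂ (proj₂ isE)))

  depthAt : Fin N → ℕ
  depthAt q = depth m a (toℕ q)

  -- the depths in a class c of level K are at most K ≤ log (N / |c|)
  class-depths : ∀ c → c ∈ cls → sumOver depthAt c ≤ length c * logDiv N (length c)
  class-depths []            c∈ = ⊥-elim (nonEmpty [] c∈ refl)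
  class-depths c@(p ∷ rest) c∈ with related c c∈ p p (here refl) (here refl)
  ... | _ , _ , j , _ , lev = begin
    sumOver depthAt c               ≤⟨ sumOver-mono c depth≤K ⟩
    sumOver (λ _ → K) c             ≡⟨ sumOver-const K c ⟩
    length c * K                    ≤⟨ *-monoʳ-≤ (length c) (logDiv-bound N (length rest) K fits) ⟩
    length c * logDiv N (length c)  ∎
    where
    open ≤-Reasoning
    K = suc j
    instance
      2^K≢0 : NonZero (2 ^ K)
      2^K≢0 = m^n≢0 2 K
    sameResidue : ∀ {q} → q ∈ c → residue K (toℕ q) ≡ residue K (toℕ p)
    sameResidue {q} q∈c with related c c∈ p q (here refl) q∈c
    ... | _ , _ , j′ , p≡q , lev′ with level-unique j′ j lev′ lev
    ...   | refl = sym p≡q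
    depth≤K : ∀ {q} → q ∈ c → depthAt q ≤ K
    depth≤K {q} q∈c = depth≤level m a K (toℕ q) λ y y<N y≡q →
      trans (coeff-fromℕ< a y<N)
        (proj₁ lev (fromℕ< y<N) (trans (cong (residue K) (toℕ-fromℕ< y<N)) (trans y≡q (sameResidue q∈c))))
    N≡ : 2 ^ (m ∸ K) * 2 ^ K ≡ N
    N≡ = trans (sym (^-distribˡ-+-* 2 (m ∸ K) K)) (trans (cong (2 ^_) (m∸n+n≡m (level<m j lev))) (sym (pow2≡2^ m)))
    inClass : ∀ {x} → x ∈ map toℕ c → x < 2 ^ (m ∸ K) * 2 ^ K × x % 2 ^ K ≡ residue K (toℕ p)
    inClass x∈ with ∈-map⁻ toℕ x∈
    ... | q , q∈c , refl = subst (toℕ q <_) (sym N≡) (toℕ<n q) , sameResidue q∈c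
    size : length c ≤ 2 ^ (m ∸ K)
    size = subst (_≤ 2 ^ (m ∸ K)) (length-map toℕ c)
      (residueClass-size (2 ^ (m ∸ K)) (residue K (toℕ p)) (map toℕ c)
        (Unique.map⁺ toℕ-injective (unique-concat uniq c∈)) inClass)
    fits : length c * 2 ^ K ≤ N
    fits = ≤-trans (*-monoˡ-≤ (2 ^ K) size) (≤-reflexive N≡)

  zeros : List (Fin N)
  zeros = filter zero? (allFin N)

  nonzeros : List (Fin N)
  nonzeros = filter (¬? ∘ zero?) (allFin N)

  zeros⊆classes : zeros ⊆ concat cls
  zeros⊆classes q∈ = Equivalence.from (zero⇔ _) (proj₂ (∈-filter⁻ zero? {xs = allFin N} q∈))

  classes⊆zeros : concat cls ⊆ zeros
  classes⊆zeros {q} q∈ = ∈-filter⁺ zero? (∈-allFin q) (Equivalence.to (zero⇔ q) q∈)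

  ζ≡ : ζ 0C _≟_ a ≡ length zeros
  ζ≡ = count-filter (λ x → x ≟ 0C) a

  #nonzeros : length nonzeros ≡ N ∸ ζ 0C _≟_ a
  #nonzeros = begin
    length nonzeros                               ≡⟨ sym (m+n∸m≡n (length zeros) _) ⟩
    length zeros + length nonzeros ∸ length zeros ≡⟨ cong₂ _∸_ (sym partition) (sym ζ≡) ⟩
    N ∸ ζ 0C _≟_ a                                ∎
    where
    open ≡-Reasoning
    partition : N ≡ length zeros + length nonzeros
    partition = trans (sym (length-tabulate {n = N} (λ i → i)))
      (subst₂ (λ u v → length (allFin N) ≡ u + v) (sumOver-one zeros) (sumOver-one nonzeros)
        (trans (sym (sumOver-one (allFin N))) (sumOver-partition zero? (λ _ → 1) (allFin N))))

  total≤bound : total m a ≤ bound 0C _≟_ a cls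
  total≤bound = begin
    total m a
      ≡⟨ sym (Σ<-allFin (depth m a) N) ⟩
    sumOver depthAt (allFin N)
      ≡⟨ sumOver-partition zero? depthAt (allFin N) ⟩
    sumOver depthAt zeros + sumOver depthAt nonzeros
      ≤⟨ +-mono-≤ (sumOver-⊆ depthAt (Unique.filter⁺ zero? (allFin⁺ N)) zeros⊆classes)
                  (sumOver-mono nonzeros (λ _ → depth≤m m a _)) ⟩
    sumOver depthAt (concat cls) + sumOver (λ _ → m) nonzeros
      ≡⟨ cong₂ _+_ (sumOver-concat depthAt cls) (sumOver-const m nonzeros) ⟩
    sumOver (sumOver depthAt) cls + length nonzeros * m
      ≤⟨ +-monoˡ-≤ _ (sumOver-mono cls (class-depths _)) ⟩
    classSum cls + length nonzeros * m
      ≡⟨ +-comm (classSum cls) _ ⟩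
    length nonzeros * m + classSum cls
      ≡⟨ cong₂ (λ u v → u * v + classSum cls) #nonzeros (sym (log-pow2 m)) ⟩
    bound 0C _≟_ a cls ∎
    where open ≤-Reasoning

  -- the class term is at most ζ log N, hence the whole bound is at most N log N
  bound≤NlogN : bound 0C _≟_ a cls ≤ N * ⌊log₂ N ⌋
  bound≤NlogN = subst (λ l → (N ∸ ζ′) * l + classSum cls ≤ N * l) (sym (log-pow2 m)) (begin
    (N ∸ ζ′) * m + classSum cls              ≤⟨ +-monoʳ-≤ ((N ∸ ζ′) * m) classSum≤ ⟩
    (N ∸ ζ′) * m + ζ′ * m                    ≡⟨ sym (*-distribʳ-+ m (N ∸ ζ′) ζ′) ⟩
    (N ∸ ζ′ + ζ′) * m                        ≡⟨ cong (_* m) (m∸n+n≡m ζ′≤N) ⟩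
    N * m                                    ∎)
    where
    open ≤-Reasoning
    ζ′ = ζ 0C _≟_ a
    ζ′≤N : ζ′ ≤ N
    ζ′≤N = subst₂ _≤_ (sym ζ≡) (length-tabulate {n = N} (λ i → i)) (length-filter zero? (allFin N))
    classTerm≤ : ∀ c → length c * logDiv N (length c) ≤ sumOver (λ _ → m) c
    classTerm≤ c = ≤-trans (*-monoʳ-≤ (length c) (logDiv≤log N (length c)))
      (≤-reflexive (trans (cong (length c *_) (log-pow2 m)) (sym (sumOver-const m c))))
    classSum≤ : classSum cls ≤ ζ′ * m
    classSum≤ = begin
      classSum cls                         ≤⟨ sumOver-mono cls (λ {c} _ → classTerm≤ c) ⟩
      sumOver (sumOver (λ _ → m)) cls      ≡⟨ sym (sumOver-concat (λ _ → m) cls) ⟩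
      sumOver (λ _ → m) (concat cls)       ≤⟨ sumOver-⊆ (λ _ → m) uniq classes⊆zeros ⟩
      sumOver (λ _ → m) zeros              ≡⟨ trans (sumOver-const m zeros) (cong (_* m) (sym ζ≡)) ⟩
      ζ′ * m                               ∎

  p₀ : Fin N
  p₀ = fromℕ< (subst (0 <_) (sym (pow2≡2^ m)) (m^n>0 2 m))

  -- the root polynomial is not identically zero: otherwise position p₀ = 0
  -- would lie in some class, whose level witness t is a non-zero position
  root-nonzero : isZero a ≡ false
  root-nonzero with isZero a in eq
  ... | false = refl
  ... | true with find (∈-concat⁻ cls (Equivalence.from (zero⇔ p₀) (isZero⇒zero a eq p₀)))
  ...   | c , c∈ , p₀∈c with related c c∈ _ _ p₀∈c p₀∈c
  ...     | _ , _ , _ , _ , _ , t , _ , t≢0 = ⊥-elim (t≢0 (isZero⇒zero a eq t))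

theorem2 : Σ ℕ λ c →
    ∀ {C : Set} (0C : C) (_≟_ : DecidableEquality C)
      (m : ℕ) (a : Vec C (pow2 m)) (cls : List (List (Fin (pow2 m)))) →
      IsEClasses 0C _≟_ a cls →
      (cost 0C _≟_ m a ≤ c * bound 0C _≟_ a cls + c)
      × (bound 0C _≟_ a cls ≤ pow2 m * ⌊log₂ (pow2 m) ⌋)
theorem2 = 8 , λ 0C _≟_ m a cls isE →
  let open Classes 0C _≟_ m a cls isE in
    ≤-trans (Algorithm.cost-bound 0C _≟_ m a root-nonzero) (+-monoˡ-≤ 8 (*-monoʳ-≤ 8 total≤bound))
  , bound≤NlogN
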